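{- For every integer $m\ge 1$, the cycle chain $\mathcal{C}_6^m$ has a prime vertex labeling.
   Context: All graphs are simple and connected. A graph with $N$ vertices has a prime vertex labeling if its vertices can be labeled bijectively with $1,2,\ldots,N$ so that adjacent vertices receive relatively prime labels. For even $n\ge 4$ and $m\ge 1$, the cycle chain $\mathcal{C}_n^m$ consists of $m$ copies $C^{(1)},\ldots,C^{(m)}$ of the $n$-cycle such that consecutive cycles $C^{(i)}$ and $C^{(i+1)}$ share exactly one common vertex, non-consecutive cycles share no vertex, and in each cycle $C^{(i)}$ with $1<i<m$ the two shared vertices (the one shared with $C^{(i-1)}$ and the one shared with $C^{(i+1)}$) are at distance $n/2$ in that cycle, i.e. they split it into two paths of equal length $n/2$. It has $m(n-1)+1$ vertices. -}

module Defs where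

open import Data.Nat using (ℕ; zero; suc; _+_; _*_; _∸_; _<_; _/_)
open import Data.Nat.Base using (_≡ᵇ_; _<ᵇ_)
open import Data.Nat.Coprimality using (Coprime)
open import Data.Bool using (if_then_else_)
open import Data.Fin using (Fin; toℕ)
open import Data.Product using (Σ; _×_)
open import Relation.Binary.PropositionalEquality using (_≡_)
open import Function.Definitions using (Bijective)

-- Vertices are 0 … m*(n-1).  Cycle i (0 ≤ i < m) visits its n vertices in
-- cyclic order at positions p = 0 … n-1.  Position 0 is the vertex i*(n-1)
-- (shared with cycle i-1), position n/2 is the vertex (i+1)*(n-1) (shared
-- with cycle i+1); the remaining positions are the fresh vertices
-- i*(n-1)+1 … i*(n-1)+(n-2).
offset : ℕ → ℕ → ℕ
offset n p = if p ≡ᵇ (n / 2) then n ∸ 1 else (if p <ᵇ (n / 2) then p else p ∸ 1)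

pos : ℕ → ℕ → ℕ → ℕ
pos n i p = i * (n ∸ 1) + offset n p

nextPos : ℕ → ℕ → ℕ
nextPos n p = if suc p ≡ᵇ n then 0 else suc p

chainSize : ℕ → ℕ → ℕ
chainSize n m = m * (n ∸ 1) + 1

-- u — v is an edge of C_n^m (each edge listed in one orientation)
data ChainEdge (n m : ℕ) : ℕ → ℕ → Set where
  edge : (i p : ℕ) → i < m → p < n →
         ChainEdge n m (pos n i p) (pos n i (nextPos n p))

-- prime vertex labeling: a bijection from the vertex set {0,…,N-1} to
-- the labels {1,…,N} (label of v is 1 + toℕ (f v)) such that adjacent
-- vertices receive relatively prime labels.
HasPrimeLabeling : ℕ → ℕ → Set
HasPrimeLabeling n m =
  Σ (Fin (chainSize n m) → Fin (chainSize n m)) λ f →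
    Bijective _≡_ _≡_ f ×
    (∀ u v → ChainEdge n m (toℕ u) (toℕ v) →
       Coprime (suc (toℕ (f u))) (suc (toℕ (f v))))

module Submission where

open import Defs
open import Data.Nat.Base
  using (ℕ; zero; suc; _+_; _*_; _∸_; _<_; _≤_; _≥_; _/_; _%_; s≤s; NonZero; ∣_-_∣)
open import Data.Nat.Properties
open import Data.Nat.DivMod
  using (m≡m%n+[m/n]*n; m%n<n; [m+kn]%n≡m%n; +-distrib-/-∣ʳ; m*n/n≡m; m<n⇒m%n≡m; m<n⇒m/n≡0)
open import Data.Nat.Divisibility using (_∣_; _∣?_; ∣-trans; ∣m+n∣m⇒∣n; n∣m*n; ∣n⇒∣m*n)
open import Data.Nat.Coprimality using (Coprime; coprime?)
open import Data.Fin using (Fin; toℕ; fromℕ<)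
open import Data.Fin.Properties using (all?; toℕ<n; toℕ-fromℕ<; toℕ-injective)
open import Data.Product using (_×_; _,_; proj₁; proj₂)
open import Data.Sum using (inj₁; inj₂)
open import Data.List using (List; []; _∷_)
open import Data.Empty using (⊥-elim)
open import Relation.Nullary.Decidable using (toWitness; _×-dec_; _→-dec_)
open import Relation.Binary.PropositionalEquality
open import Relation.Binary using (tri<; tri≈; tri>)
open import Function.Consequences.Propositional
  using (inverseᵇ⇒bijective; strictlyInverseˡ⇒inverseˡ; strictlyInverseʳ⇒inverseʳ)
open import Function.Definitions using (Bijective)
open import Data.Nat.Solver using (module +-*-Solver)
open +-*-Solver using (solve; _:+_; _:*_; con; _:=_)

-- In the model of Defs the vertices of C₆^m are 0 … 5m, and cycle i runs
-- through 5i, 5i+1, 5i+2, 5i+5, 5i+3, 5i+4.  We label vertex v by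
-- 1 + F v, where F is the period-30 extension of a fixed permutation
-- `blockPerm` of 0 … 29; F permutes each block 5j+1 … 5j+5.
--
-- 1. Two coprime numbers stay coprime when both are shifted by a multiple
--    of their distance (`coprime-shift`).
-- 2. Periodic extensions of a permutation τ of [0,P) are bijections of ℕ,
--    commute with shifts by multiples of P, and preserve every segment
--    [0, t + qP] when τ preserves [0, t].
-- 3. Finitely many facts about `blockPerm` are checked by decision: it is a
--    permutation with an explicit inverse, it preserves the segments
--    [0, 5j], and on the six cycles 0 … 5 every edge gets coprime labels
--    whose distance divides 30.
-- 4. Since cycle i + 6q is cycle i shifted by 30q, (1) and (2) transfer the
--    edge condition to all cycles, and the segment property lets F restrict
--    to a bijection of the vertex set {0, …, 5m}.

fin-to-bounded : ∀ {n} {P : ℕ → Set} → (∀ (i : Fin n) → P (toℕ i)) → ∀ i → i < n → P i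
fin-to-bounded {P = P} all-fin i i<n = subst P (toℕ-fromℕ< i<n) (all-fin (fromℕ< i<n))

∣-difference : ∀ {c m n} → m ≤ n → c ∣ m → c ∣ n → c ∣ n ∸ m
∣-difference {c} m≤n c∣m c∣n = ∣m+n∣m⇒∣n (subst (c ∣_) (sym (m+[n∸m]≡n m≤n)) c∣n) c∣m

∣-distance : ∀ {c a b} → c ∣ a → c ∣ b → c ∣ ∣ a - b ∣
∣-distance {c} {a} {b} c∣a c∣b with ≤-total a b
... | inj₁ a≤b = subst (c ∣_) (sym (m≤n⇒∣m-n∣≡n∸m a≤b)) (∣-difference a≤b c∣a c∣b)
... | inj₂ b≤a = subst (c ∣_) (sym (trans (∣-∣-comm a b) (m≤n⇒∣m-n∣≡n∸m b≤a)))
                       (∣-difference b≤a c∣b c∣a)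

-- If x is coprime to the distance d = ∣ x - y ∣ (equivalently, x and y
-- are coprime), then so are x + k and y + k for every multiple k of d: a
-- common divisor of the shifted numbers divides d, hence k, hence x.
coprime-shift : ∀ {x y k} → Coprime x ∣ x - y ∣ → ∣ x - y ∣ ∣ k → Coprime (x + k) (y + k)
coprime-shift {x} {y} {k} x⊥d d∣k {c} (c∣x+k , c∣y+k) = x⊥d (c∣x , c∣d)
  where
  c∣d : c ∣ ∣ x - y ∣
  c∣d = subst (c ∣_) (trans (cong₂ ∣_-_∣ (+-comm x k) (+-comm y k)) (∣m+n-m+o∣≡∣n-o∣ k x y))
              (∣-distance c∣x+k c∣y+k)
  c∣x : c ∣ x
  c∣x = ∣m+n∣m⇒∣n (subst (c ∣_) (+-comm x k) c∣x+k) (∣-trans c∣d d∣k)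

module PeriodicExtension (P : ℕ) {{_ : NonZero P}} where

  extend : (ℕ → ℕ) → ℕ → ℕ
  extend τ v = τ (v % P) + v / P * P

  extend-below : ∀ τ {s} → s < P → extend τ s ≡ τ s
  extend-below τ {s} s<P = begin
    τ (s % P) + s / P * P  ≡⟨ cong₂ (λ r q → τ r + q * P) (m<n⇒m%n≡m s<P) (m<n⇒m/n≡0 s<P) ⟩
    τ s + 0                ≡⟨ +-identityʳ (τ s) ⟩
    τ s                    ∎
    where open ≡-Reasoning

  extend-shift : ∀ τ v q → extend τ (v + q * P) ≡ extend τ v + q * P
  extend-shift τ v q = begin
    τ ((v + q * P) % P) + (v + q * P) / P * P
      ≡⟨ cong₂ (λ r n → τ r + n * P) ([m+kn]%n≡m%n v q P) quotient ⟩
    τ (v % P) + (v / P + q) * P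
      ≡⟨ cong (τ (v % P) +_) (*-distribʳ-+ P (v / P) q) ⟩
    τ (v % P) + (v / P * P + q * P)
      ≡⟨ sym (+-assoc (τ (v % P)) (v / P * P) (q * P)) ⟩
    (τ (v % P) + v / P * P) + q * P
      ∎
    where
    open ≡-Reasoning
    quotient : (v + q * P) / P ≡ v / P + q
    quotient = trans (+-distrib-/-∣ʳ v (n∣m*n q)) (cong (v / P +_) (m*n/n≡m q P))

  extend-residue : ∀ τ {s} q → s < P → extend τ (s + q * P) ≡ τ s + q * P
  extend-residue τ {s} q s<P = trans (extend-shift τ s q) (cong (_+ q * P) (extend-below τ s<P))

  extend-inverse : ∀ τ σ → (∀ s → s < P → τ s < P) → (∀ s → s < P → σ (τ s) ≡ s) →
                   ∀ v → extend σ (extend τ v) ≡ v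
  extend-inverse τ σ τ<P σ∘τ v = begin
    extend σ (τ r + v / P * P)  ≡⟨ extend-residue σ (v / P) (τ<P r r<P) ⟩
    σ (τ r) + v / P * P         ≡⟨ cong (_+ v / P * P) (σ∘τ r r<P) ⟩
    r + v / P * P               ≡⟨ sym (m≡m%n+[m/n]*n v P) ⟩
    v                           ∎
    where
    open ≡-Reasoning
    r = v % P
    r<P = m%n<n v P

  -- If τ maps [0,P) into itself and preserves the segment [0,t] (t < P),
  -- its extension preserves every segment [0, t + qP]: arguments in an
  -- earlier period stay below qP, those in period q stay below t + qP, and
  -- later periods lie outside the segment.
  extend-preserves-segment : ∀ τ {t} → (∀ s → s < P → τ s < P) → t < P →
                             (∀ s → s < P → s ≤ t → τ s ≤ t) →
                             ∀ q v → v ≤ t + q * P → extend τ v ≤ t + q * P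
  extend-preserves-segment τ {t} τ<P t<P τ-segment q v v≤bound
    with <-cmp (v / P) q
  ... | tri< p<q _ _ = begin
    τ r + p * P   ≤⟨ <⇒≤ (+-monoˡ-< (p * P) (τ<P r r<P)) ⟩
    suc p * P     ≤⟨ *-monoˡ-≤ P p<q ⟩
    q * P         ≤⟨ m≤n+m (q * P) t ⟩
    t + q * P     ∎
    where
    open ≤-Reasoning
    r = v % P
    p = v / P
    r<P = m%n<n v P
  ... | tri≈ _ refl _ = +-monoˡ-≤ (q * P) (τ-segment r r<P r≤t)
    where
    r = v % P
    r<P = m%n<n v P
    r≤t : r ≤ t
    r≤t = +-cancelʳ-≤ (q * P) r t (subst (_≤ t + q * P) (m≡m%n+[m/n]*n v P) v≤bound)
  ... | tri> _ _ q<p = ⊥-elim (<-irrefl refl (begin-strict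
    t + q * P     <⟨ +-monoˡ-< (q * P) t<P ⟩
    suc q * P     ≤⟨ *-monoˡ-≤ P q<p ⟩
    v / P * P     ≤⟨ m≤n+m (v / P * P) (v % P) ⟩
    v % P + v / P * P ≡⟨ sym (m≡m%n+[m/n]*n v P) ⟩
    v             ≤⟨ v≤bound ⟩
    t + q * P     ∎))
    where open ≤-Reasoning

open PeriodicExtension 30

-- i-th entry of a list (0 past its end).
nth : List ℕ → ℕ → ℕ
nth [] _ = 0
nth (x ∷ xs) zero = x
nth (x ∷ xs) (suc n) = nth xs n

-- A permutation of 0 … 29 whose periodic extension permutes each block
-- 5j+1 … 5j+5; it is chosen so that adjacent vertices of the cycles 0 … 5 get coprime labels
-- whose distance divides 30.
blockPerm : ℕ → ℕ
blockPerm = nth (0 ∷ 1 ∷ 2 ∷ 4 ∷ 5 ∷ 3 ∷ 6 ∷ 7 ∷ 9 ∷ 8 ∷ 10 ∷ 11 ∷ 12 ∷ 14 ∷ 13 ∷ 15 ∷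
               16 ∷ 17 ∷ 19 ∷ 20 ∷ 18 ∷ 21 ∷ 22 ∷ 24 ∷ 23 ∷ 25 ∷ 26 ∷ 27 ∷ 29 ∷ 28 ∷ [])

blockPerm⁻¹ : ℕ → ℕ
blockPerm⁻¹ = nth (0 ∷ 1 ∷ 2 ∷ 5 ∷ 3 ∷ 4 ∷ 6 ∷ 7 ∷ 9 ∷ 8 ∷ 10 ∷ 11 ∷ 12 ∷ 14 ∷ 13 ∷ 15 ∷
                 16 ∷ 17 ∷ 20 ∷ 18 ∷ 19 ∷ 21 ∷ 22 ∷ 24 ∷ 23 ∷ 25 ∷ 26 ∷ 27 ∷ 29 ∷ 28 ∷ [])

-- The label (minus one) of vertex v, and its inverse.
label label⁻¹ : ℕ → ℕ
label = extend blockPerm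
label⁻¹ = extend blockPerm⁻¹

InverseOn30 : (ℕ → ℕ) → (ℕ → ℕ) → Set
InverseOn30 τ σ = ∀ (s : Fin 30) → τ (toℕ s) < 30 × σ (τ (toℕ s)) ≡ toℕ s

maps-into-30 : ∀ τ σ → InverseOn30 τ σ → ∀ s → s < 30 → τ s < 30
maps-into-30 τ σ inv = fin-to-bounded {P = λ s → τ s < 30} (λ s → proj₁ (inv s))

undoes-on-30 : ∀ τ σ → InverseOn30 τ σ → ∀ s → s < 30 → σ (τ s) ≡ s
undoes-on-30 τ σ inv = fin-to-bounded {P = λ s → σ (τ s) ≡ s} (λ s → proj₂ (inv s))

blockPerm-inverse : InverseOn30 blockPerm blockPerm⁻¹
blockPerm-inverse = toWitness {a? = all? λ s → (_ <? 30) ×-dec (_ ≟ toℕ s)} _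

blockPerm⁻¹-inverse : InverseOn30 blockPerm⁻¹ blockPerm
blockPerm⁻¹-inverse = toWitness {a? = all? λ s → (_ <? 30) ×-dec (_ ≟ toℕ s)} _

PreservesBlocks : (ℕ → ℕ) → Set
PreservesBlocks τ = ∀ (j : Fin 6) (s : Fin 30) → toℕ s ≤ toℕ j * 5 → τ (toℕ s) ≤ toℕ j * 5

preserves-segment : ∀ {τ} → PreservesBlocks τ → ∀ j → j < 6 → ∀ s → s < 30 → s ≤ j * 5 → τ s ≤ j * 5
preserves-segment {τ} blocks j j<6 s s<30 =
  fin-to-bounded {P = λ k → s ≤ k * 5 → τ s ≤ k * 5}
    (λ j → fin-to-bounded {P = λ r → r ≤ toℕ j * 5 → τ r ≤ toℕ j * 5} (blocks j) s s<30) j j<6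

blockPerm-blocks : PreservesBlocks blockPerm
blockPerm-blocks = toWitness {a? = all? λ j → all? λ s → (_ ≤? _) →-dec (_ ≤? _)} _

blockPerm⁻¹-blocks : PreservesBlocks blockPerm⁻¹
blockPerm⁻¹-blocks = toWitness {a? = all? λ j → all? λ s → (_ ≤? _) →-dec (_ ≤? _)} _

-- An edge a — b is good when the label 1 + a is coprime to the distance
-- ∣ a - b ∣ of the two labels (so the labels are coprime) and this
-- distance divides the period 30.
GoodEdge : ℕ → ℕ → Set
GoodEdge a b = Coprime (suc a) ∣ a - b ∣ × ∣ a - b ∣ ∣ 30

GoodCycleEdge : ℕ → ℕ → Set
GoodCycleEdge i p = GoodEdge (label (pos 6 i p)) (label (pos 6 i (nextPos 6 p)))

first-cycles-good : ∀ (i p : Fin 6) → GoodCycleEdge (toℕ i) (toℕ p)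
first-cycles-good = toWitness {a? = all? λ i → all? λ p → coprime? _ _ ×-dec (_ ∣? 30)} _

pos-shift : ∀ j q p → pos 6 (j + q * 6) p ≡ pos 6 j p + q * 30
pos-shift j q p = solve 3 (λ j q o → (j :+ q :* con 6) :* con 5 :+ o := (j :* con 5 :+ o) :+ q :* con 30)
                          refl j q (offset 6 p)

edge-coprime : ∀ {m a b} → ChainEdge 6 m a b → Coprime (suc (label a)) (suc (label b))
edge-coprime (edge i p _ p<6) =
  subst₂ (λ a b → Coprime (suc a) (suc b)) (sym (label-shift p)) (sym (label-shift (nextPos 6 p)))
    (coprime-shift (proj₁ good) (∣n⇒∣m*n (i / 6) (proj₂ good)))
  where
  label-shift : ∀ p′ → label (pos 6 i p′) ≡ label (pos 6 (i % 6) p′) + i / 6 * 30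
  label-shift p′ = begin
    label (pos 6 i p′)                        ≡⟨ cong (λ k → label (pos 6 k p′)) (m≡m%n+[m/n]*n i 6) ⟩
    label (pos 6 (i % 6 + i / 6 * 6) p′)      ≡⟨ cong label (pos-shift (i % 6) (i / 6) p′) ⟩
    label (pos 6 (i % 6) p′ + i / 6 * 30)     ≡⟨ extend-shift blockPerm (pos 6 (i % 6) p′) (i / 6) ⟩
    label (pos 6 (i % 6) p′) + i / 6 * 30     ∎
    where open ≡-Reasoning
  good : GoodCycleEdge (i % 6) p
  good = fin-to-bounded {P = λ k → GoodCycleEdge k p} (λ j → fin-to-bounded {P = GoodCycleEdge (toℕ j)}
           (first-cycles-good j) p p<6) (i % 6) (m%n<n i 6)

extension-bounded : ∀ τ → (∀ s → s < 30 → τ s < 30) → PreservesBlocks τ →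
                    ∀ m v → v < chainSize 6 m → extend τ v < chainSize 6 m
extension-bounded τ τ<30 τ-blocks m v v<size =
  subst (extend τ v <_) (+-comm 1 (m * 5)) (s≤s (subst (extend τ v ≤_) (sym 5m≡t+q*30)
    (extend-preserves-segment τ τ<30 t<30 τ-segment (m / 6) v
      (subst (v ≤_) 5m≡t+q*30 (m<1+n⇒m≤n (subst (v <_) (+-comm (m * 5) 1) v<size))))))
  where
  t = m % 6 * 5
  5m≡t+q*30 : m * 5 ≡ t + m / 6 * 30
  5m≡t+q*30 = trans (cong (_* 5) (m≡m%n+[m/n]*n m 6))
                    (solve 2 (λ j q → (j :+ q :* con 6) :* con 5 := j :* con 5 :+ q :* con 30)
                           refl (m % 6) (m / 6))
  t<30 : t < 30
  t<30 = *-monoˡ-< 5 (m%n<n m 6)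
  τ-segment : ∀ s → s < 30 → s ≤ t → τ s ≤ t
  τ-segment = preserves-segment τ-blocks (m % 6) (m%n<n m 6)

restrict : ∀ {N} (f : ℕ → ℕ) → (∀ v → v < N → f v < N) → Fin N → Fin N
restrict f f<N u = fromℕ< (f<N (toℕ u) (toℕ<n u))

restrict-toℕ : ∀ {N} f (f<N : ∀ v → v < N → f v < N) u → toℕ (restrict f f<N u) ≡ f (toℕ u)
restrict-toℕ f f<N u = toℕ-fromℕ< (f<N (toℕ u) (toℕ<n u))

restrict-inverse : ∀ {N} f g (f<N : ∀ v → v < N → f v < N) (g<N : ∀ v → v < N → g v < N) →
                   (∀ v → g (f v) ≡ v) → ∀ u → restrict g g<N (restrict f f<N u) ≡ u
restrict-inverse f g f<N g<N g∘f u = toℕ-injective (begin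
  toℕ (restrict g g<N (restrict f f<N u))  ≡⟨ restrict-toℕ g g<N (restrict f f<N u) ⟩
  g (toℕ (restrict f f<N u))               ≡⟨ cong g (restrict-toℕ f f<N u) ⟩
  g (f (toℕ u))                            ≡⟨ g∘f (toℕ u) ⟩
  toℕ u                                    ∎)
  where open ≡-Reasoning

restrict-bijective : ∀ {N} f g (f<N : ∀ v → v < N → f v < N) (g<N : ∀ v → v < N → g v < N) →
                     (∀ v → g (f v) ≡ v) → (∀ v → f (g v) ≡ v) → Bijective _≡_ _≡_ (restrict f f<N)
restrict-bijective f g f<N g<N g∘f f∘g = inverseᵇ⇒bijective {f⁻¹ = restrict g g<N}
  ( strictlyInverseˡ⇒inverseˡ (restrict f f<N) (restrict-inverse g f g<N f<N f∘g)
  , strictlyInverseʳ⇒inverseʳ (restrict f f<N) (restrict-inverse f g f<N g<N g∘f))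

label⁻¹∘label : ∀ v → label⁻¹ (label v) ≡ v
label⁻¹∘label = extend-inverse blockPerm blockPerm⁻¹
  (maps-into-30 blockPerm blockPerm⁻¹ blockPerm-inverse) (undoes-on-30 blockPerm blockPerm⁻¹ blockPerm-inverse)

label∘label⁻¹ : ∀ v → label (label⁻¹ v) ≡ v
label∘label⁻¹ = extend-inverse blockPerm⁻¹ blockPerm
  (maps-into-30 blockPerm⁻¹ blockPerm blockPerm⁻¹-inverse) (undoes-on-30 blockPerm⁻¹ blockPerm blockPerm⁻¹-inverse)

label<size : ∀ m v → v < chainSize 6 m → label v < chainSize 6 m
label<size = extension-bounded blockPerm (maps-into-30 blockPerm blockPerm⁻¹ blockPerm-inverse) blockPerm-blocks

label⁻¹<size : ∀ m v → v < chainSize 6 m → label⁻¹ v < chainSize 6 m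
label⁻¹<size = extension-bounded blockPerm⁻¹ (maps-into-30 blockPerm⁻¹ blockPerm blockPerm⁻¹-inverse) blockPerm⁻¹-blocks

theorem3 : (m : ℕ) → m ≥ 1 → HasPrimeLabeling 6 m
theorem3 m _ = f , bijective , coprime-on-edges
  where
  f : Fin (chainSize 6 m) → Fin (chainSize 6 m)
  f = restrict label (label<size m)
  bijective : Bijective _≡_ _≡_ f
  bijective = restrict-bijective label label⁻¹ (label<size m) (label⁻¹<size m) label⁻¹∘label label∘label⁻¹
  coprime-on-edges : ∀ u v → ChainEdge 6 m (toℕ u) (toℕ v) →
                     Coprime (suc (toℕ (f u))) (suc (toℕ (f v)))
  coprime-on-edges u v uv = subst₂ (λ a b → Coprime (suc a) (suc b))
    (sym (restrict-toℕ label (label<size m) u)) (sym (restrict-toℕ label (label<size m) v)) (edge-coprime uv)
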